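{- Let $P$ be a set of $n$ points in $\mathbb{R}$, each belonging to exactly one of the groups $\mathbf{g}_1,\dots,\mathbf{g}_k$, and let $m$ be a number of buckets dividing every $|\mathbf{g}_i|$. Regardless of how the points are distributed and ordered, there exists a cut-based hashmap with $m$ buckets that is $0$-unfair, i.e., in which every bucket contains exactly $|\mathbf{g}_i|/m$ points of $\mathbf{g}_i$ for every $i$, so that $\sum_{j=1}^m(\alpha_{i,j}/|\mathbf{g}_i|)^2=\frac1m$ for every group $i$.
   Context: Let $p_1,\dots,p_n$ be the points of $P$ sorted by value (ties broken arbitrarily). A cut-based hashmap with $m$ buckets is a partition of the sequence $p_1,\dots,p_n$ into contiguous blocks (bins), obtained by placing boundaries between consecutive points, together with an assignment of each bin to one of the $m$ buckets (a bucket may receive several non-consecutive bins). $\alpha_{i,j}$ denotes the number of points of $\mathbf{g}_i$ assigned to bucket $j$; the hashmap is $0$-unfair if $\max_i\sum_j(\alpha_{i,j}/|\mathbf{g}_i|)^2\le \frac1m$. -}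

module Defs where

open import Data.Nat using (ℕ; _≤_; _*_; _^_)
open import Data.Fin using (Fin)
open import Data.Fin.Properties using (_≟_)
open import Data.List using (List; []; _∷_; map; filter; length; zip; concatMap; replicate; allFin)
open import Data.Nat.ListAction using (sum)
open import Data.List.Relation.Unary.All using (All)
open import Data.Product using (_×_; _,_; proj₁; proj₂)
open import Relation.Binary.PropositionalEquality using (_≡_)
open import Relation.Nullary.Decidable using (_×-dec_)

-- A point set of n points, sorted by value (ties broken arbitrarily), is
-- represented by the sequence of group labels of p_1,...,p_n in that order:
-- a function  label : Fin n → Fin k  (point p_(t+1) belongs to group g_(label t)).
-- Only the order of the values matters for cut-based hashmaps.

labels : ∀ {n k} → (Fin n → Fin k) → List (Fin k)
labels {n} label = map label (allFin n)

groupSize : ∀ {n k} → (Fin n → Fin k) → Fin k → ℕ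
groupSize label i = length (filter (λ c → c ≟ i) (labels label))

-- A cut-based hashmap on n sorted points with m buckets: the list of bins
-- in left-to-right order, each bin given by its length (number of
-- consecutive points, at least 1) and the bucket it is assigned to.
record CutHashmap (n m : ℕ) : Set where
  field
    bins       : List (ℕ × Fin m)
    binsNonempty : All (λ b → 1 ≤ proj₁ b) bins
    binsCover  : sum (map proj₁ bins) ≡ n

bucketSeq : ∀ {n m} → CutHashmap n m → List (Fin m)
bucketSeq h = concatMap (λ b → replicate (proj₁ b) (proj₂ b)) (CutHashmap.bins h)

α : ∀ {n k m} → (Fin n → Fin k) → CutHashmap n m → Fin k → Fin m → ℕ
α label h i j =
  length (filter (λ q → (proj₁ q ≟ i) ×-dec (proj₂ q ≟ j))
                 (zip (labels label) (bucketSeq h)))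

sumSq : ∀ {n k m} → (Fin n → Fin k) → CutHashmap n m → Fin k → ℕ
sumSq {m = m} label h i = sum (map (λ j → α label h i j ^ 2) (allFin m))

-- 0-unfair: for every group i,  Σ_j (α_{i,j}/|g_i|)^2 ≤ 1/m,
-- stated with denominators cleared:  m · Σ_j α_{i,j}^2 ≤ |g_i|^2.
ZeroUnfair : ∀ {n k m} → (Fin n → Fin k) → CutHashmap n m → Set
ZeroUnfair {m = m} label h = ∀ i → m * sumSq label h i ≤ groupSize label i ^ 2

-- Make every point its own bin and deal the points of each group out to the
-- buckets cyclically: the r-th point of group i (counted from 0) goes to bucket
-- r mod m.  Bucket j then receives those points of g_i whose rank r < |g_i| is
-- congruent to j, and when m divides |g_i| every residue class modulo m meets
-- [0, |g_i|) exactly |g_i|/m times.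

module Submission where

open import Defs
open import Data.Nat using (ℕ; NonZero; _*_; _≤_; zero; suc; _+_; _^_; _<_; s≤s; z≤n)
open import Data.Nat.Divisibility using (_∣_; divides)
open import Data.Nat.DivMod using (_mod_; [m+n]%n≡m%n; m<n⇒m%n≡m)
open import Data.Nat.Properties
  using ( *-comm; +-assoc; +-suc; +-identityʳ; <-irrefl; <-trans; <-≤-trans; +-monoʳ-<
        ; m≤m+n; m≤n⇒∃[o]m+o≡n; ≤-reflexive)
open import Data.Nat.Solver using (module +-*-Solver)
open import Data.Fin using (Fin; toℕ)
open import Data.Fin.Properties using (_≟_; toℕ<n; toℕ-fromℕ<; fromℕ<-toℕ; fromℕ<-cong)
open import Data.List using (List; []; _∷_; map; filter; length; zip; allFin)
open import Data.List.Properties using (length-map; length-tabulate)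
open import Data.List.Relation.Unary.All using (All; []; _∷_)
open import Data.Nat.ListAction using (sum)
open import Data.Vec.Functional using (updateAt)
open import Data.Vec.Functional.Properties using (updateAt-updates; updateAt-minimal)
open import Data.Product using (Σ; _×_; _,_; proj₁; proj₂)
open import Function using (_∘_)
open import Relation.Binary.PropositionalEquality
  using (_≡_; _≢_; refl; sym; trans; cong; cong₂; module ≡-Reasoning)
open import Data.Empty using (⊥-elim)
open import Relation.Nullary using (Dec; yes; no)
open import Relation.Nullary.Decidable using (_×-dec_)

open ≡-Reasoning
open +-*-Solver using (solve; _:*_; _:^_; _:=_)

indicator : ∀ {p} {P : Set p} → Dec P → ℕ
indicator (yes _) = 1
indicator (no _)  = 0

sum-map-const : ∀ {A : Set} (f : A → ℕ) {v} (xs : List A) →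
                (∀ x → f x ≡ v) → sum (map f xs) ≡ length xs * v
sum-map-const f []       f≡v = refl
sum-map-const f (x ∷ xs) f≡v = cong₂ _+_ (f≡v x) (sum-map-const f xs f≡v)

module _ (m : ℕ) .{{_ : NonZero m}} where

  mod-periodic : ∀ a → (a + m) mod m ≡ a mod m
  mod-periodic a = fromℕ<-cong _ _ ([m+n]%n≡m%n a m) _ _

  mod-below⇒≡toℕ : ∀ {t j} → t < m → t mod m ≡ j → t ≡ toℕ j
  mod-below⇒≡toℕ {t} t<m refl = sym (trans (toℕ-fromℕ< _) (m<n⇒m%n≡m t<m))

  toℕ-mod : ∀ j → toℕ j mod m ≡ j
  toℕ-mod j = trans (fromℕ<-cong _ _ (m<n⇒m%n≡m (toℕ<n j)) _ (toℕ<n j)) (fromℕ<-toℕ j _)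

  hits : Fin m → ℕ → ℕ → ℕ
  hits j a zero    = 0
  hits j a (suc s) = indicator (a mod m ≟ j) + hits j (suc a) s

  hits-++ : ∀ j a s r → hits j a (s + r) ≡ hits j a s + hits j (a + s) r
  hits-++ j a zero    r = cong (λ b → hits j b r) (sym (+-identityʳ a))
  hits-++ j a (suc s) r = begin
    indicator (a mod m ≟ j) + hits j (suc a) (s + r)
      ≡⟨ cong (indicator (a mod m ≟ j) +_) (hits-++ j (suc a) s r) ⟩
    indicator (a mod m ≟ j) + (hits j (suc a) s + hits j (suc a + s) r)
      ≡⟨ cong (λ b → indicator (a mod m ≟ j) + (hits j (suc a) s + hits j b r)) (sym (+-suc a s)) ⟩
    indicator (a mod m ≟ j) + (hits j (suc a) s + hits j (a + suc s) r)
      ≡⟨ sym (+-assoc (indicator (a mod m ≟ j)) _ _) ⟩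
    hits j a (suc s) + hits j (a + suc s) r ∎

  hits-periodic : ∀ j a s → hits j (a + m) s ≡ hits j a s
  hits-periodic j a zero    = refl
  hits-periodic j a (suc s) =
    cong₂ _+_ (cong (λ b → indicator (b ≟ j)) (mod-periodic a)) (hits-periodic j (suc a) s)

  hits-miss : ∀ j a s → (∀ d → d < s → (a + d) mod m ≢ j) → hits j a s ≡ 0
  hits-miss j a zero    _    = refl
  hits-miss j a (suc s) miss with a mod m ≟ j
  ... | yes a↦j = ⊥-elim (miss 0 (s≤s z≤n) (trans (cong (_mod m) (+-identityʳ a)) a↦j))
  ... | no _    = hits-miss j (suc a) s λ d d<s → miss (suc d) (s≤s d<s) ∘ trans (cong (_mod m) (+-suc a d))

  hits-period : ∀ j → hits j 0 m ≡ 1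
  hits-period j with m≤n⇒∃[o]m+o≡n (toℕ<n j)
  ... | r , 1+j+r≡m = begin
    hits j 0 m                                      ≡⟨ cong (hits j 0) m≡j+1+r ⟩
    hits j 0 (toℕ j + suc r)                        ≡⟨ hits-++ j 0 (toℕ j) (suc r) ⟩
    hits j 0 (toℕ j) + hits j (toℕ j) (suc r)       ≡⟨ cong₂ _+_ below (cong₂ _+_ at above) ⟩
    1 ∎
    where
    m≡j+1+r : m ≡ toℕ j + suc r
    m≡j+1+r = sym (trans (+-suc (toℕ j) r) 1+j+r≡m)

    below : hits j 0 (toℕ j) ≡ 0
    below = hits-miss j 0 (toℕ j) λ d d<j d↦j →
      <-irrefl (mod-below⇒≡toℕ (<-trans d<j (toℕ<n j)) d↦j) d<j

    at : indicator (toℕ j mod m ≟ j) ≡ 1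
    at with toℕ j mod m ≟ j
    ... | yes _  = refl
    ... | no j↛j = ⊥-elim (j↛j (toℕ-mod j))

    above : hits j (suc (toℕ j)) r ≡ 0
    above = hits-miss j (suc (toℕ j)) r λ d d<r t↦j →
      let t<m = <-≤-trans (+-monoʳ-< (suc (toℕ j)) d<r) (≤-reflexive 1+j+r≡m)
      in <-irrefl (sym (mod-below⇒≡toℕ t<m t↦j)) (m≤m+n (suc (toℕ j)) d)

  hits-periods : ∀ j q → hits j 0 (q * m) ≡ q
  hits-periods j zero    = refl
  hits-periods j (suc q) = begin
    hits j 0 (m + q * m)                ≡⟨ hits-++ j 0 m (q * m) ⟩
    hits j 0 m + hits j (0 + m) (q * m) ≡⟨ cong₂ _+_ (hits-period j) (hits-periodic j 0 (q * m)) ⟩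
    1 + hits j 0 (q * m)                ≡⟨ cong suc (hits-periods j q) ⟩
    suc q ∎

  -- c i is the number of points of group i dealt out so far.
  roundRobin : ∀ {k} → (Fin k → ℕ) → List (Fin k) → List (Fin m)
  roundRobin c []       = []
  roundRobin c (x ∷ xs) = c x mod m ∷ roundRobin (updateAt c x suc) xs

  length-roundRobin : ∀ {k} (c : Fin k → ℕ) xs → length (roundRobin c xs) ≡ length xs
  length-roundRobin c []       = refl
  length-roundRobin c (x ∷ xs) = cong suc (length-roundRobin (updateAt c x suc) xs)

  count-roundRobin : ∀ {k} (c : Fin k → ℕ) xs i j →
    length (filter (λ q → (proj₁ q ≟ i) ×-dec (proj₂ q ≟ j)) (zip xs (roundRobin c xs)))
      ≡ hits j (c i) (length (filter (λ x → x ≟ i) xs))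
  count-roundRobin c []       i j = refl
  count-roundRobin c (x ∷ xs) i j with x ≟ i
  ... | no x≢i = trans (count-roundRobin (updateAt c x suc) xs i j)
                       (cong (λ a → hits j a (length (filter (λ y → y ≟ i) xs)))
                             (updateAt-minimal i x {suc} c (x≢i ∘ sym)))
  ... | yes refl with c x mod m ≟ j | count-roundRobin (updateAt c x suc) xs x j
  ...   | yes _ | ih rewrite updateAt-updates x {suc} c = cong suc ih
  ...   | no _  | ih rewrite updateAt-updates x {suc} c = ih

unitBin : ∀ {m} → Fin m → ℕ × Fin m
unitBin b = 1 , b

singletonBins : ∀ {n m} (bs : List (Fin m)) → length bs ≡ n → CutHashmap n m
singletonBins bs refl = record
  { bins         = map unitBin bs
  ; binsNonempty = nonempty bs
  ; binsCover    = cover bs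
  }
  where
  nonempty : ∀ {m} (bs : List (Fin m)) → All (λ b → 1 ≤ proj₁ b) (map unitBin bs)
  nonempty []       = []
  nonempty (_ ∷ bs) = s≤s z≤n ∷ nonempty bs

  cover : ∀ {m} (bs : List (Fin m)) → sum (map proj₁ (map unitBin bs)) ≡ length bs
  cover []       = refl
  cover (_ ∷ bs) = cong suc (cover bs)

bucketSeq-singletonBins : ∀ {n m} (bs : List (Fin m)) (len : length bs ≡ n) →
                          bucketSeq (singletonBins bs len) ≡ bs
bucketSeq-singletonBins []       refl = refl
bucketSeq-singletonBins (b ∷ bs) refl = cong (b ∷_) (bucketSeq-singletonBins bs refl)

sumSq-uniform : ∀ {n k m} (label : Fin n → Fin k) (h : CutHashmap n m) i {q} →
                (∀ j → α label h i j ≡ q) → sumSq label h i ≡ m * q ^ 2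
sumSq-uniform {m = m} label h i {q} α≡q = begin
  sum (map (λ j → α label h i j ^ 2) (allFin m)) ≡⟨ sum-map-const _ (allFin m) (cong (_^ 2) ∘ α≡q) ⟩
  length (allFin m) * q ^ 2                     ≡⟨ cong (_* q ^ 2) (length-tabulate {n = m} (λ j → j)) ⟩
  m * q ^ 2 ∎

module _ {n k : ℕ} (m : ℕ) .{{_ : NonZero m}} (label : Fin n → Fin k) where

  length-roundRobin-labels : length (roundRobin m (λ _ → 0) (labels label)) ≡ n
  length-roundRobin-labels = begin
    length (roundRobin m (λ _ → 0) (labels label)) ≡⟨ length-roundRobin m _ (labels label) ⟩
    length (map label (allFin n))                  ≡⟨ length-map label (allFin n) ⟩
    length (allFin n)                              ≡⟨ length-tabulate {n = n} (λ t → t) ⟩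
    n ∎

  roundRobinHashmap : CutHashmap n m
  roundRobinHashmap = singletonBins (roundRobin m (λ _ → 0) (labels label)) length-roundRobin-labels

  α-roundRobinHashmap : ∀ i j → α label roundRobinHashmap i j ≡ hits m j 0 (groupSize label i)
  α-roundRobinHashmap i j = begin
    α label roundRobinHashmap i j
      ≡⟨ cong (λ bs → length (filter (λ q → (proj₁ q ≟ i) ×-dec (proj₂ q ≟ j)) (zip (labels label) bs)))
              (bucketSeq-singletonBins _ length-roundRobin-labels) ⟩
    length (filter (λ q → (proj₁ q ≟ i) ×-dec (proj₂ q ≟ j))
                   (zip (labels label) (roundRobin m (λ _ → 0) (labels label))))
      ≡⟨ count-roundRobin m (λ _ → 0) (labels label) i j ⟩
    hits m j 0 (groupSize label i) ∎

theorem4p1 : (n k m : ℕ) → .{{_ : NonZero m}} → (label : Fin n → Fin k) →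
    (∀ i → m ∣ groupSize label i) →
    Σ (CutHashmap n m) (λ h →
      ZeroUnfair label h × (∀ i j → m * α label h i j ≡ groupSize label i))
theorem4p1 n k m label m∣g = h , zeroUnfair , balanced
  where
  h : CutHashmap n m
  h = roundRobinHashmap m label

  α≡share : ∀ i j q → groupSize label i ≡ q * m → α label h i j ≡ q
  α≡share i j q g≡qm = trans (α-roundRobinHashmap m label i j)
                              (trans (cong (hits m j 0) g≡qm) (hits-periods m j q))

  balanced : ∀ i j → m * α label h i j ≡ groupSize label i
  balanced i j with m∣g i
  ... | divides q g≡qm = begin
    m * α label h i j ≡⟨ cong (m *_) (α≡share i j q g≡qm) ⟩
    m * q             ≡⟨ *-comm m q ⟩
    q * m             ≡⟨ sym g≡qm ⟩
    groupSize label i ∎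

  zeroUnfair : ZeroUnfair label h
  zeroUnfair i with m∣g i
  ... | divides q g≡qm = ≤-reflexive (begin
    m * sumSq label h i   ≡⟨ cong (m *_) (sumSq-uniform label h i (λ j → α≡share i j q g≡qm)) ⟩
    m * (m * q ^ 2)       ≡⟨ solve 2 (λ a b → a :* (a :* b :^ 2) := (b :* a) :^ 2) refl m q ⟩
    (q * m) ^ 2           ≡⟨ cong (_^ 2) (sym g≡qm) ⟩
    groupSize label i ^ 2 ∎)
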